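{- Let $p$ be an odd prime, $n=(p-1)/2$, and let $i,j \in \{1,2,\dots,n\}$. Then: (a) Let $x_1,x_2$ be two different vertices of $\partial W_i$ and let $y_1,y_2$ be two different vertices of $\partial W_i$ (the sets $\{x_1,x_2\}$ and $\{y_1,y_2\}$ may intersect). Then there exist a permutation $\sigma$ of $\{1,2\}$ and two vertex-disjoint paths $p_1,p_2$ in the graph $\partial W_i$ such that $p_1$ connects $x_1$ with $y_{\sigma(1)}$ and $p_2$ connects $x_2$ with $y_{\sigma(2)}$ (a path of length zero being allowed when the endpoints coincide). (b) Every vertex $x$ of $\partial W_i$ has precisely two neighbours (in $\Pi_p$) among the vertices of $\partial W_j$. (c) If additionally $i \neq j$, then there exists a bijection $\Phi: V(\partial W_i) \to V(\partial W_j)$ such that $v$ and $\Phi(v)$ are adjacent in $\Pi_p$ for all vertices $v$ of $\partial W_i$.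
   Context: For an odd prime $p$, the Platonic graph $\Pi_p$ has vertex set the equivalence classes $[\lambda,\mu] = \{\pm(\lambda,\mu)\}$ of pairs $(\lambda,\mu) \in \mathbb{Z}_p \times \mathbb{Z}_p$ with $(\lambda,\mu) \neq (0,0)$; two vertices $[\lambda,\mu]$ and $[\nu,\omega]$ are adjacent if and only if $\lambda\omega - \mu\nu = \pm 1$ in $\mathbb{Z}_p$. For $i \in \{1,\dots,n\}$ with $n=(p-1)/2$ (viewing $i$ as an element of $\mathbb{Z}_p$), $\partial W_i$ denotes the induced subgraph of $\Pi_p$ whose vertex set is the set of neighbours of the vertex $[i,0]$ in $\Pi_p$. -}

module Defs where

open import Data.Nat using (ℕ; zero; suc; _+_; _*_; _∸_; _%_; NonZero; _≡ᵇ_; _<ᵇ_; _≤ᵇ_)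
open import Data.Fin using (Fin; toℕ)
open import Data.Bool using (Bool; true; false; _∧_; _∨_; not; T)
open import Data.Product using (Σ; _×_; _,_; proj₁; proj₂)
open import Data.Sum using (_⊎_)
open import Data.Empty using (⊥)
open import Data.List using (List; []; _∷_)
open import Data.List.Relation.Unary.All using (All)
open import Data.List.Relation.Unary.Unique.Propositional using (Unique)
open import Data.List.Membership.Propositional using (_∈_)
open import Relation.Binary.PropositionalEquality using (_≡_; _≢_)

-- Everything is parametrised by the modulus p (arithmetic in ℤ_p is done
-- on representatives in {0,…,p-1} with _%_, hence the NonZero instance).
module _ (p : ℕ) .{{_ : NonZero p}} where

  negN : ℕ → ℕ
  negN a = (p ∸ a) % p

  -- det (λ,μ) (ν,ω) = λω - μν  as an element of ℤ_p (representative in {0..p-1})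
  det : ℕ × ℕ → ℕ × ℕ → ℕ
  det (l , m) (n , w) = ((l * w) % p + (p ∸ (m * n) % p)) % p

  adjB : ℕ × ℕ → ℕ × ℕ → Bool
  adjB u v = (det u v ≡ᵇ 1 % p) ∨ (det u v ≡ᵇ negN 1)

  Pair : Set
  Pair = Fin p × Fin p

  toN : Pair → ℕ × ℕ
  toN (a , b) = toℕ a , toℕ b

  lexB : ℕ × ℕ → ℕ × ℕ → Bool
  lexB (a , b) (c , d) = (a <ᵇ c) ∨ ((a ≡ᵇ c) ∧ (b ≤ᵇ d))

  -- (λ,μ) is the canonical representative of its class {±(λ,μ)}:
  -- it is nonzero and lexicographically ≤ its negative.
  canonB : Pair → Bool
  canonB (a , b) =
    not ((toℕ a ≡ᵇ 0) ∧ (toℕ b ≡ᵇ 0)) ∧ lexB (toℕ a , toℕ b) (negN (toℕ a) , negN (toℕ b))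

  -- Vertices of the Platonic graph Π_p: classes [λ,μ] = {±(λ,μ)}, (λ,μ) ≠ (0,0),
  -- each represented by its unique canonical representative.
  Vertex : Set
  Vertex = Σ Pair (λ v → T (canonB v))

  Adj : Vertex → Vertex → Set
  Adj u v = T (adjB (toN (proj₁ u)) (toN (proj₁ v)))

  -- v is a vertex of ∂W_i, i.e. a neighbour of [i,0] in Π_p
  InDW : ℕ → Vertex → Set
  InDW i v = T (adjB (i , 0) (toN (proj₁ v)))

  DW : ℕ → Set
  DW i = Σ Vertex (InDW i)

  data Walk : Vertex → Vertex → Set where
    stop : (x : Vertex) → Walk x x
    step : {x y z : Vertex} → Adj x y → Walk y z → Walk x z

  verts : {x y : Vertex} → Walk x y → List Vertex
  verts (stop x) = x ∷ []
  verts (step {x = x} _ w) = x ∷ verts w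

  -- a path in the induced subgraph ∂W_i: all vertices in ∂W_i, no repeated vertex
  -- (edges of the induced subgraph are exactly the Π_p-edges between its vertices)
  IsPathIn : (i : ℕ) {x y : Vertex} → Walk x y → Set
  IsPathIn i w = All (InDW i) (verts w) × Unique (verts w)

  PathIn : ℕ → Vertex → Vertex → Set
  PathIn i x y = Σ (Walk x y) (IsPathIn i)

  VertexDisjoint : {x y x' y' : Vertex} → Walk x y → Walk x' y' → Set
  VertexDisjoint w w' = ∀ v → v ∈ verts w → v ∈ verts w' → ⊥

  DisjointPaths : ℕ → Vertex → Vertex → Vertex → Vertex → Set
  DisjointPaths i x₁ x₂ a b =
    Σ (PathIn i x₁ a) λ P₁ → Σ (PathIn i x₂ b) λ P₂ → VertexDisjoint (proj₁ P₁) (proj₁ P₂)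

  -- there is a permutation σ of {1,2} (identity or swap) with disjoint paths
  -- x₁ → y_σ(1), x₂ → y_σ(2) in ∂W_i
  Linkage : ℕ → Vertex → Vertex → Vertex → Vertex → Set
  Linkage i x₁ x₂ y₁ y₂ = DisjointPaths i x₁ x₂ y₁ y₂ ⊎ DisjointPaths i x₁ x₂ y₂ y₁

  ExactlyTwoNbrsIn : ℕ → Vertex → Set
  ExactlyTwoNbrsIn j x =
    Σ Vertex λ y₁ → Σ Vertex λ y₂ →
      (y₁ ≢ y₂) × (InDW j y₁ × Adj x y₁) × (InDW j y₂ × Adj x y₂) ×
      (∀ y → InDW j y → Adj x y → (y ≡ y₁) ⊎ (y ≡ y₂))

module Submission where

-- Let c = i⁻¹ in ℤ_p. The neighbours of [i,0] are exactly the classes [α,c], α ∈ ℤ_p, and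
-- [α,c] ~ [α′,c] iff α − α′ = ±i, so ∂W_i is the p-cycle t ↦ [α₀ + t·i, c] and two disjoint
-- paths can be taken to be two disjoint arcs of it. With d = j⁻¹, [α,c] ~ [β,d] iff
-- αd − cβ = ±1, i.e. β = i(αd ∓ 1): these are the two neighbours in ∂W_j, and α ↦ i(αd − 1)
-- is a bijection of ℤ_p, which gives Φ.

open import Defs
open import Data.Nat using (ℕ; _∸_; _/_; _%_; _≤_; NonZero)
open import Data.Nat.Primality using (Prime)
open import Data.Product using (Σ; _×_; proj₁)
open import Function.Bundles using (_⤖_; Bijection)
open import Relation.Binary.PropositionalEquality using (_≡_; _≢_)

open import Data.Bool using (Bool; not; T; _∧_)
open import Data.Bool.Properties using (T-∧; T-∨; T-irrelevant)
open import Data.Empty using (⊥; ⊥-elim)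
open import Data.Fin using (toℕ; fromℕ<)
open import Data.Fin.Properties using (toℕ-injective; toℕ-fromℕ<; toℕ<n)
open import Data.Integer using (ℤ; +_; -[1+_]; _+_; _-_; _*_; -_; 0ℤ; 1ℤ; -1ℤ)
open import Data.Integer.DivMod using (_%ℕ_; _/ℕ_; n%ℕd<d; a≡a%ℕn+[a/ℕn]*n)
import Data.Integer.Properties as ℤ
open import Data.Integer.Tactic.RingSolver using (solve-∀; solve)
open import Data.List using ([]; _∷_)
open import Data.List.Membership.Propositional using (_∈_)
open import Data.List.Relation.Unary.All as All using (All)
import Data.List.Relation.Unary.AllPairs as AllPairs
open import Data.List.Relation.Unary.Any using (here; there)
open import Data.List.Relation.Unary.Unique.Propositional using (Unique)
open import Data.Nat as ℕ using (zero; suc; _<_; s≤s; _≤′_; ≤′-refl; ≤′-step; _≤‴_; ≤‴-refl; ≤‴-step)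
open import Data.Nat.Coprimality using (prime⇒coprime; coprime-Bézout)
open import Data.Nat.DivMod using (m/n≤m; n%n≡0; m≡m%n+[m/n]*n; m%n<n; m<n⇒m%n≡m; [m+kn]%n≡m%n)
open import Data.Nat.GCD using (module Bézout)
open import Data.Nat.Primality using (prime⇒nonTrivial)
import Data.Nat.Properties as ℕ
open import Data.Nat.Properties using (≤‴⇒≤; ≤′⇒≤; ≤⇒≤‴; ≤⇒≤′)
open import Data.Product using (_,_; proj₂)
import Data.Product.Relation.Binary.Lex.Strict as Lex
open import Data.Product.Relation.Binary.Pointwise.NonDependent using (≡×≡⇒≡)
open import Data.Sum using (_⊎_; inj₁; inj₂; swap)
open import Function.Base using (_∘_)
open import Function.Bundles using (Equivalence; _⇔_; mk⇔; mk↔ₛ′)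
open import Function.Properties.Inverse using (↔⇒⤖)
open import Relation.Binary.Bundles using (Setoid)
open import Relation.Binary.Definitions using (tri<; tri≈; tri>)
open import Relation.Binary.PropositionalEquality using (module ≡-Reasoning; refl; sym; trans; cong; cong₂; subst)
open import Relation.Nullary using (¬_; yes; no)

open Equivalence using (to; from)

module Congruence (m : ℤ) where

  infix 4 _≈_
  record _≈_ (x y : ℤ) : Set where
    constructor congruent
    field
      quotient : ℤ
      equation : x ≡ y + quotient * m

  ≈-refl : ∀ {x} → x ≈ x
  ≈-refl {x} = congruent 0ℤ (solve (x ∷ m ∷ []))

  ≈-trans : ∀ {x y z} → x ≈ y → y ≈ z → x ≈ z
  ≈-trans {z = z} (congruent k refl) (congruent l refl) =
    congruent (k + l) (solve (z ∷ k ∷ l ∷ m ∷ []))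

  ≈-sym : ∀ {x y} → x ≈ y → y ≈ x
  ≈-sym {y = y} (congruent k refl) = congruent (- k) (solve (y ∷ k ∷ m ∷ []))

  ≡⇒≈ : ∀ {x y} → x ≡ y → x ≈ y
  ≡⇒≈ refl = ≈-refl

  +-cong : ∀ {x x′ y y′} → x ≈ x′ → y ≈ y′ → x + y ≈ x′ + y′
  +-cong {x′ = x′} {y′ = y′} (congruent k refl) (congruent l refl) =
    congruent (k + l) (solve (x′ ∷ y′ ∷ k ∷ l ∷ m ∷ []))

  *-cong : ∀ {x x′ y y′} → x ≈ x′ → y ≈ y′ → x * y ≈ x′ * y′
  *-cong {x′ = x′} {y′ = y′} (congruent k refl) (congruent l refl) =
    congruent (k * y′ + x′ * l + k * l * m) (solve (x′ ∷ y′ ∷ k ∷ l ∷ m ∷ []))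

  -‿cong : ∀ {x y} → x ≈ y → - x ≈ - y
  -‿cong {y = y} (congruent k refl) = congruent (- k) (solve (y ∷ k ∷ m ∷ []))

  ≈-setoid : Setoid _ _
  ≈-setoid = record
    { Carrier = ℤ ; _≈_ = _≈_
    ; isEquivalence = record { refl = ≈-refl ; sym = ≈-sym ; trans = ≈-trans } }

  x+y≡m⇒x≈-y : ∀ {x y} → x + y ≡ m → x ≈ - y
  x+y≡m⇒x≈-y {x} {y} refl = congruent 1ℤ (solve (x ∷ y ∷ []))

  +-cancelˡ : ∀ a {x y} → a + x ≈ a + y → x ≈ y
  +-cancelˡ a {x} {y} a+x≈a+y = begin
    x              ≡⟨ solve (a ∷ x ∷ []) ⟩
    - a + (a + x)  ≈⟨ +-cong (≈-refl { - a}) a+x≈a+y ⟩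
    - a + (a + y)  ≡⟨ solve (a ∷ y ∷ []) ⟩
    y              ∎
    where open import Relation.Binary.Reasoning.Setoid ≈-setoid

  ≈-neg-flip : ∀ {a c} → a ≈ - c → c ≈ - a
  ≈-neg-flip {a} {c} a≈-c = ≈-sym (≈-trans (-‿cong a≈-c) (≡⇒≈ (ℤ.neg-involutive c)))

  1+b≡km⇒-b≈1 : ∀ {b k} → 1ℤ + b ≡ k * m → - b ≈ 1ℤ
  1+b≡km⇒-b≈1 {b} {k} eq = congruent (- k) (begin
    - b              ≡⟨ solve (b ∷ []) ⟩
    1ℤ + - (1ℤ + b)  ≡⟨ cong (λ t → 1ℤ + - t) eq ⟩
    1ℤ + - (k * m)   ≡⟨ solve (k ∷ m ∷ []) ⟩
    1ℤ + - k * m     ∎)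
    where open ≡-Reasoning

  1+km≡b⇒b≈1 : ∀ {b k} → 1ℤ + k * m ≡ b → b ≈ 1ℤ
  1+km≡b⇒b≈1 {k = k} refl = congruent k refl

  m≈0 : m ≈ 0ℤ
  m≈0 = congruent 1ℤ (solve (m ∷ []))


ℤ² : ℕ × ℕ → ℤ × ℤ
ℤ² (a , b) = + a , + b

detℤ : ℤ × ℤ → ℤ × ℤ → ℤ
detℤ (a , b) (c , d) = a * d - b * c

-- The identities are stated with detℤ unfolded, which the ring solver cannot do itself.
det-negˡ : ∀ a b c d → - ((- a) * d - (- b) * c) ≡ a * d - b * c
det-negˡ = solve-∀

det-negʳ : ∀ a b c d → - (a * (- d) - b * (- c)) ≡ a * d - b * c
det-negʳ = solve-∀

det-neg : ∀ a b c d → (- a) * (- d) - (- b) * (- c) ≡ a * d - b * c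
det-neg = solve-∀

det-antisym : ∀ a b c d → - (a * d - b * c) ≡ c * b - d * a
det-antisym = solve-∀

module Residues (p : ℕ) .{{_ : NonZero p}} where

  open Congruence (+ p) public
  open import Relation.Binary.Reasoning.Setoid ≈-setoid

  %-≈ : ∀ n → + (n % p) ≈ + n
  %-≈ n = ≈-sym (congruent (+ (n / p)) (trans (cong +_ (m≡m%n+[m/n]*n n p))
    (trans (ℤ.pos-+ (n % p) _) (cong (λ t → + (n % p) + t) (ℤ.pos-* (n / p) p)))))

  %ℕ-≈ : ∀ x → + (x %ℕ p) ≈ x
  %ℕ-≈ x = ≈-sym (congruent (x /ℕ p) (a≡a%ℕn+[a/ℕn]*n x p))

  a≡b+kp⇒a%p≡b%p : ∀ a b k → + a ≡ + b + + k * + p → a % p ≡ b % p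
  a≡b+kp⇒a%p≡b%p a b k eq = trans (cong (_% p) (ℤ.+-injective (trans eq
    (trans (cong (λ t → + b + t) (sym (ℤ.pos-* k p))) (sym (ℤ.pos-+ b (k ℕ.* p)))))))
    ([m+kn]%n≡m%n b k p)

  ≈⇒%≡ : ∀ {a b} → + a ≈ + b → a % p ≡ b % p
  ≈⇒%≡ {a} {b} (congruent (+ k) eq) = a≡b+kp⇒a%p≡b%p a b k eq
  ≈⇒%≡ {a} {b} (congruent -[1+ k ] eq) = sym (a≡b+kp⇒a%p≡b%p b a (suc k)
    (trans (y≡[y-km]+km (+ b) (+ suc k) (+ p)) (cong (λ t → t + + suc k * + p) (sym eq))))
    where
    y≡[y-km]+km : ∀ y k m → y ≡ (y + (- k) * m) + k * m
    y≡[y-km]+km = solve-∀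

  ≈⇒≡ : ∀ {a b} → a < p → b < p → + a ≈ + b → a ≡ b
  ≈⇒≡ a<p b<p a≈b = trans (sym (m<n⇒m%n≡m a<p)) (trans (≈⇒%≡ a≈b) (m<n⇒m%n≡m b<p))

  ∸-≈ : ∀ {a} → a ≤ p → + (p ∸ a) ≈ - + a
  ∸-≈ {a} a≤p = x+y≡m⇒x≈-y (trans (sym (ℤ.pos-+ (p ∸ a) a)) (cong +_ (ℕ.m∸n+n≡m a≤p)))

  negN-≈ : ∀ {a} → a ≤ p → + negN p a ≈ - + a
  negN-≈ a≤p = ≈-trans (%-≈ _) (∸-≈ a≤p)

  det-≈ : ∀ P Q → + det p P Q ≈ detℤ (ℤ² P) (ℤ² Q)
  det-≈ (l , m) (n , w) = begin
    + det p (l , m) (n , w)                         ≈⟨ %-≈ _ ⟩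
    + ((l ℕ.* w) % p ℕ.+ (p ∸ (m ℕ.* n) % p))       ≡⟨ ℤ.pos-+ ((l ℕ.* w) % p) _ ⟩
    + ((l ℕ.* w) % p) + + (p ∸ (m ℕ.* n) % p)      ≈⟨ +-cong (%-≈ _) (∸-≈ (ℕ.<⇒≤ (m%n<n _ p))) ⟩
    + (l ℕ.* w) - + ((m ℕ.* n) % p)                 ≈⟨ +-cong (≈-refl {+ (l ℕ.* w)}) (-‿cong (%-≈ _)) ⟩
    + (l ℕ.* w) - + (m ℕ.* n)                       ≡⟨ cong₂ _-_ (ℤ.pos-* l w) (ℤ.pos-* m n) ⟩
    + l * + w - + m * + n                           ∎

  ≉-within-period : ∀ {s q} → s < q → q < s ℕ.+ p → + s ≈ + q → ⊥
  ≉-within-period {s} {q} s<q q<s+p s≈q = ℕ.<⇒≢ (ℕ.m<n⇒0<n∸m s<q) (sym d≡0)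
    where
    q≡s+d : + q ≡ + s + + (q ∸ s)
    q≡s+d = trans (cong +_ (sym (ℕ.m+[n∸m]≡n (ℕ.<⇒≤ s<q)))) (ℤ.pos-+ s (q ∸ s))
    d≡0 : q ∸ s ≡ 0
    d≡0 = ≈⇒≡ (ℕ.m<n+o⇒m∸n<o q s q<s+p) (ℕ.>-nonZero⁻¹ p)
      (≈-sym (+-cancelˡ (+ s) (≈-trans (≡⇒≈ (ℤ.+-identityʳ (+ s))) (≈-trans s≈q (≡⇒≈ q≡s+d)))))

module Vertices (p : ℕ) .{{_ : NonZero p}} where

  open Residues p

  ⟦_⟧ : Vertex p → ℤ × ℤ
  ⟦ v ⟧ = ℤ² (toN p (proj₁ v))

  Is±1 : ℤ → Set
  Is±1 x = x ≈ 1ℤ ⊎ x ≈ -1ℤ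

  Is±1-resp-≈ : ∀ {x y} → x ≈ y → Is±1 x → Is±1 y
  Is±1-resp-≈ x≈y (inj₁ x≈1) = inj₁ (≈-trans (≈-sym x≈y) x≈1)
  Is±1-resp-≈ x≈y (inj₂ x≈-1) = inj₂ (≈-trans (≈-sym x≈y) x≈-1)

  Is±1-neg : ∀ {x} → Is±1 x → Is±1 (- x)
  Is±1-neg (inj₁ x≈1) = inj₂ (-‿cong x≈1)
  Is±1-neg (inj₂ x≈-1) = inj₁ (-‿cong x≈-1)

  adjB⇒±1 : ∀ P Q → T (adjB p P Q) → Is±1 (detℤ (ℤ² P) (ℤ² Q))
  adjB⇒±1 P Q adj with to T-∨ adj
  ... | inj₁ det≡1 = inj₁ (≈-trans (≈-sym (det-≈ P Q))
    (≈-trans (≡⇒≈ (cong +_ (ℕ.≡ᵇ⇒≡ _ _ det≡1))) (%-≈ 1)))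
  ... | inj₂ det≡-1 = inj₂ (≈-trans (≈-sym (det-≈ P Q))
    (≈-trans (≡⇒≈ (cong +_ (ℕ.≡ᵇ⇒≡ _ _ det≡-1))) (negN-≈ (ℕ.>-nonZero⁻¹ p))))

  ±1⇒adjB : ∀ P Q → Is±1 (detℤ (ℤ² P) (ℤ² Q)) → T (adjB p P Q)
  ±1⇒adjB P Q (inj₁ det≈1) = from T-∨ (inj₁ (ℕ.≡⇒≡ᵇ _ _
    (≈⇒≡ (m%n<n _ p) (m%n<n 1 p) (≈-trans (det-≈ P Q) (≈-trans det≈1 (≈-sym (%-≈ 1)))))))
  ±1⇒adjB P Q (inj₂ det≈-1) = from T-∨ (inj₂ (ℕ.≡⇒≡ᵇ _ _
    (≈⇒≡ (m%n<n _ p) (m%n<n _ p)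
      (≈-trans (det-≈ P Q) (≈-trans det≈-1 (≈-sym (negN-≈ (ℕ.>-nonZero⁻¹ p))))))))

  DW-≡ : ∀ {k} {u v : DW p k} → proj₁ u ≡ proj₁ v → u ≡ v
  DW-≡ {u = v , v∈∂W} {.v , v∈∂W′} refl = cong (v ,_) (T-irrelevant v∈∂W v∈∂W′)

  infix 4 _≈±_
  data _≈±_ : ℤ × ℤ → ℤ × ℤ → Set where
    same     : ∀ {a b c d} → a ≈ c → b ≈ d → (a , b) ≈± (c , d)
    opposite : ∀ {a b c d} → a ≈ - c → b ≈ - d → (a , b) ≈± (c , d)

  ≈±-refl : ∀ {P} → P ≈± P
  ≈±-refl = same ≈-refl ≈-refl

  ≈±-reflexive : ∀ {P Q} → P ≡ Q → P ≈± Q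
  ≈±-reflexive refl = ≈±-refl

  ≈±-sym : ∀ {P Q} → P ≈± Q → Q ≈± P
  ≈±-sym (same a≈c b≈d) = same (≈-sym a≈c) (≈-sym b≈d)
  ≈±-sym (opposite a≈-c b≈-d) = opposite (≈-neg-flip a≈-c) (≈-neg-flip b≈-d)

  ≈±-trans : ∀ {P Q R} → P ≈± Q → Q ≈± R → P ≈± R
  ≈±-trans (same h₁ h₂) (same g₁ g₂) = same (≈-trans h₁ g₁) (≈-trans h₂ g₂)
  ≈±-trans (same h₁ h₂) (opposite g₁ g₂) = opposite (≈-trans h₁ g₁) (≈-trans h₂ g₂)
  ≈±-trans (opposite h₁ h₂) (same g₁ g₂) =
    opposite (≈-trans h₁ (-‿cong g₁)) (≈-trans h₂ (-‿cong g₂))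
  ≈±-trans (opposite h₁ h₂) (opposite g₁ g₂) =
    same (≈-trans h₁ (≈-sym (≈-neg-flip g₁))) (≈-trans h₂ (≈-sym (≈-neg-flip g₂)))

  toN-injective : ∀ {u v : Vertex p} → toN p (proj₁ u) ≡ toN p (proj₁ v) → u ≡ v
  toN-injective {(a , b) , t} {(a′ , b′) , t′} eq
    with toℕ-injective (cong proj₁ eq) | toℕ-injective (cong proj₂ eq)
  ... | refl | refl = cong ((a , b) ,_) (T-irrelevant t t′)

  infix 4 _≤ₗₑₓ_
  _≤ₗₑₓ_ : ℕ × ℕ → ℕ × ℕ → Set
  _≤ₗₑₓ_ = Lex.×-Lex _≡_ _<_ _≤_

  lexB⇒≤ₗₑₓ : ∀ P Q → T (lexB p P Q) → P ≤ₗₑₓ Q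
  lexB⇒≤ₗₑₓ (a , b) (c , d) lex with to T-∨ lex
  ... | inj₁ a<c = inj₁ (ℕ.<ᵇ⇒< a c a<c)
  ... | inj₂ a≡c∧b≤d = inj₂ (ℕ.≡ᵇ⇒≡ a c (proj₁ (to T-∧ a≡c∧b≤d)) ,
                             ℕ.≤ᵇ⇒≤ b d (proj₂ (to T-∧ a≡c∧b≤d)))

  ≤ₗₑₓ⇒lexB : ∀ P Q → P ≤ₗₑₓ Q → T (lexB p P Q)
  ≤ₗₑₓ⇒lexB (a , b) (c , d) (inj₁ a<c) = from T-∨ (inj₁ (ℕ.<⇒<ᵇ a<c))
  ≤ₗₑₓ⇒lexB (a , b) (c , d) (inj₂ (a≡c , b≤d)) =
    from T-∨ (inj₂ (from T-∧ (ℕ.≡⇒≡ᵇ a c a≡c , ℕ.≤⇒≤ᵇ b≤d)))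

  ≤ₗₑₓ-antisym : ∀ {P Q} → P ≤ₗₑₓ Q → Q ≤ₗₑₓ P → P ≡ Q
  ≤ₗₑₓ-antisym P≤Q Q≤P = ≡×≡⇒≡
    (Lex.×-antisymmetric {_≈₁_ = _≡_} {_<₁_ = _<_} {_≈₂_ = _≡_} {_<₂_ = _≤_}
      sym ℕ.<-irrefl ℕ.<-asym ℕ.≤-antisym P≤Q Q≤P)

  ≤ₗₑₓ-total : ∀ P Q → P ≤ₗₑₓ Q ⊎ Q ≤ₗₑₓ P
  ≤ₗₑₓ-total = Lex.×-total₂ {_≈₁_ = _≡_} {_<₁_ = _<_} {_<₂_ = _≤_} sym ℕ.<-cmp ℕ.≤-total

  infix 8 -ₚ_
  -ₚ_ : ℕ × ℕ → ℕ × ℕ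
  -ₚ (a , b) = negN p a , negN p b

  negN≡ : ∀ {a c} → a < p → c < p → + a ≈ - + c → negN p a ≡ c
  negN≡ a<p c<p a≈-c =
    ≈⇒≡ (m%n<n _ p) c<p (≈-trans (negN-≈ (ℕ.<⇒≤ a<p)) (≈-sym (≈-neg-flip a≈-c)))

  ⟦⟧-injective : ∀ {u v} → ⟦ u ⟧ ≈± ⟦ v ⟧ → u ≡ v
  ⟦⟧-injective {u} {v} (same a≈c b≈d) = toN-injective
    (cong₂ _,_ (≈⇒≡ (toℕ<n _) (toℕ<n _) a≈c) (≈⇒≡ (toℕ<n _) (toℕ<n _) b≈d))
  ⟦⟧-injective {u} {v} (opposite a≈-c b≈-d) = toN-injective (≤ₗₑₓ-antisym
    (subst (toN p (proj₁ u) ≤ₗₑₓ_) -u≡v (canonical-≤ₗₑₓ u))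
    (subst (toN p (proj₁ v) ≤ₗₑₓ_) -v≡u (canonical-≤ₗₑₓ v)))
    where
    canonical-≤ₗₑₓ : ∀ w → toN p (proj₁ w) ≤ₗₑₓ -ₚ toN p (proj₁ w)
    canonical-≤ₗₑₓ w = lexB⇒≤ₗₑₓ _ _ (proj₂ (to T-∧ (proj₂ w)))
    -u≡v : -ₚ toN p (proj₁ u) ≡ toN p (proj₁ v)
    -u≡v = cong₂ _,_ (negN≡ (toℕ<n _) (toℕ<n _) a≈-c) (negN≡ (toℕ<n _) (toℕ<n _) b≈-d)
    -v≡u : -ₚ toN p (proj₁ v) ≡ toN p (proj₁ u)
    -v≡u = cong₂ _,_ (negN≡ (toℕ<n _) (toℕ<n _) (≈-neg-flip a≈-c))
                     (negN≡ (toℕ<n _) (toℕ<n _) (≈-neg-flip b≈-d))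

  negN-involutive : ∀ {a} → a < p → negN p (negN p a) ≡ a
  negN-involutive a<p = negN≡ (m%n<n _ p) a<p (negN-≈ (ℕ.<⇒≤ a<p))

  T-not-both-zero : ∀ a b → ¬ (a ≡ 0 × b ≡ 0) → T (not ((a ℕ.≡ᵇ 0) ∧ (b ℕ.≡ᵇ 0)))
  T-not-both-zero zero    zero    a,b≢0 = a,b≢0 (refl , refl)
  T-not-both-zero zero    (suc _) _     = _
  T-not-both-zero (suc _) _       _     = _

  canonical-vertex : ∀ {a b} (a<p : a < p) (b<p : b < p) → ¬ (a ≡ 0 × b ≡ 0) →
    (a , b) ≤ₗₑₓ -ₚ (a , b) → Σ (Vertex p) λ v → toN p (proj₁ v) ≡ (a , b)
  canonical-vertex {a} {b} a<p b<p a,b≢0 a,b≤-a,b =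
    ((fromℕ< a<p , fromℕ< b<p) , subst (T ∘ canonicalℕ) (sym toN≡)
      (from T-∧ (T-not-both-zero a b a,b≢0 , ≤ₗₑₓ⇒lexB _ _ a,b≤-a,b))) , toN≡
    where
    toN≡ : (toℕ (fromℕ< a<p) , toℕ (fromℕ< b<p)) ≡ (a , b)
    toN≡ = cong₂ _,_ (toℕ-fromℕ< a<p) (toℕ-fromℕ< b<p)
    canonicalℕ : ℕ × ℕ → Bool
    canonicalℕ (x , y) = not ((x ℕ.≡ᵇ 0) ∧ (y ℕ.≡ᵇ 0)) ∧ lexB p (x , y) (-ₚ (x , y))

  vertex-of-residues : ∀ {a b} → a < p → b < p → ¬ (a ≡ 0 × b ≡ 0) →
    Σ (Vertex p) λ v → ⟦ v ⟧ ≈± (+ a , + b)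
  vertex-of-residues {a} {b} a<p b<p a,b≢0 with ≤ₗₑₓ-total (a , b) (-ₚ (a , b))
  ... | inj₁ a,b≤-a,b with canonical-vertex a<p b<p a,b≢0 a,b≤-a,b
  ...   | v , toN≡ = v , ≈±-reflexive (cong ℤ² toN≡)
  vertex-of-residues {a} {b} a<p b<p a,b≢0 | inj₂ -a,b≤a,b
    with canonical-vertex (m%n<n _ p) (m%n<n _ p) -a,b≢0
           (subst (-ₚ (a , b) ≤ₗₑₓ_) (sym -ₚ-involutive) -a,b≤a,b)
    where
    -ₚ-involutive : -ₚ -ₚ (a , b) ≡ (a , b)
    -ₚ-involutive = cong₂ _,_ (negN-involutive a<p) (negN-involutive b<p)
    negN≡0 : ∀ {x} → x < p → negN p x ≡ 0 → x ≡ 0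
    negN≡0 {x} x<p -x≡0 =
      trans (sym (negN-involutive x<p)) (trans (cong (negN p) -x≡0) (n%n≡0 p))
    -a,b≢0 : ¬ (negN p a ≡ 0 × negN p b ≡ 0)
    -a,b≢0 (-a≡0 , -b≡0) = a,b≢0 (negN≡0 a<p -a≡0 , negN≡0 b<p -b≡0)
  ... | v , toN≡ = v , ≈±-trans (≈±-reflexive (cong ℤ² toN≡))
                                (opposite (negN-≈ (ℕ.<⇒≤ a<p)) (negN-≈ (ℕ.<⇒≤ b<p)))

  vertex-of : ∀ α β → ¬ (α ≈ 0ℤ × β ≈ 0ℤ) → Σ (Vertex p) λ v → ⟦ v ⟧ ≈± (α , β)
  vertex-of α β α,β≉0 with vertex-of-residues (n%ℕd<d α p) (n%ℕd<d β p) residues≢0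
    where
    residue≈0 : ∀ γ → γ %ℕ p ≡ 0 → γ ≈ 0ℤ
    residue≈0 γ γ%p≡0 = ≈-trans (≈-sym (%ℕ-≈ γ)) (≡⇒≈ (cong +_ γ%p≡0))
    residues≢0 : ¬ (α %ℕ p ≡ 0 × β %ℕ p ≡ 0)
    residues≢0 (α%p≡0 , β%p≡0) = α,β≉0 (residue≈0 α α%p≡0 , residue≈0 β β%p≡0)
  ... | v , v≈±res = v , ≈±-trans v≈±res (same (%ℕ-≈ α) (%ℕ-≈ β))

  det-cong : ∀ {a a′ b b′ c c′ d d′} → a ≈ a′ → b ≈ b′ → c ≈ c′ → d ≈ d′ →
             detℤ (a , b) (c , d) ≈ detℤ (a′ , b′) (c′ , d′)
  det-cong a≈ b≈ c≈ d≈ = +-cong (*-cong a≈ d≈) (-‿cong (*-cong b≈ c≈))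

  Is±1-det-resp-≈± : ∀ {P P′ Q Q′} → P ≈± P′ → Q ≈± Q′ →
                     Is±1 (detℤ P Q) → Is±1 (detℤ P′ Q′)
  Is±1-det-resp-≈± (same a≈ b≈) (same c≈ d≈) = Is±1-resp-≈ (det-cong a≈ b≈ c≈ d≈)
  Is±1-det-resp-≈± {P′ = a , b} {Q′ = c , d} (opposite a≈ b≈) (same c≈ d≈) ±1 =
    Is±1-resp-≈ (≈-trans (-‿cong (det-cong a≈ b≈ c≈ d≈)) (≡⇒≈ (det-negˡ a b c d))) (Is±1-neg ±1)
  Is±1-det-resp-≈± {P′ = a , b} {Q′ = c , d} (same a≈ b≈) (opposite c≈ d≈) ±1 =
    Is±1-resp-≈ (≈-trans (-‿cong (det-cong a≈ b≈ c≈ d≈)) (≡⇒≈ (det-negʳ a b c d))) (Is±1-neg ±1)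
  Is±1-det-resp-≈± {P′ = a , b} {Q′ = c , d} (opposite a≈ b≈) (opposite c≈ d≈) =
    Is±1-resp-≈ (≈-trans (det-cong a≈ b≈ c≈ d≈) (≡⇒≈ (det-neg a b c d)))

  Adj⇔±1 : ∀ {u v P Q} → ⟦ u ⟧ ≈± P → ⟦ v ⟧ ≈± Q → Adj p u v ⇔ Is±1 (detℤ P Q)
  Adj⇔±1 {u} {v} u≈±P v≈±Q = mk⇔
    (Is±1-det-resp-≈± u≈±P v≈±Q ∘ adjB⇒±1 (toN p (proj₁ u)) (toN p (proj₁ v)))
    (±1⇒adjB (toN p (proj₁ u)) (toN p (proj₁ v)) ∘ Is±1-det-resp-≈± (≈±-sym u≈±P) (≈±-sym v≈±Q))

  InDW⇔±1 : ∀ {i v Q} → ⟦ v ⟧ ≈± Q → InDW p i v ⇔ Is±1 (detℤ (+ i , 0ℤ) Q)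
  InDW⇔±1 {i} {v} v≈±Q = mk⇔
    (Is±1-det-resp-≈± {P = + i , 0ℤ} ≈±-refl v≈±Q ∘ adjB⇒±1 (i , 0) (toN p (proj₁ v)))
    (±1⇒adjB (i , 0) (toN p (proj₁ v)) ∘ Is±1-det-resp-≈± {P = + i , 0ℤ} ≈±-refl (≈±-sym v≈±Q))

  Adj-sym : ∀ {u v} → Adj p u v → Adj p v u
  Adj-sym {u} {v} adj = from (Adj⇔±1 {v} {u} ≈±-refl ≈±-refl)
    (Is±1-resp-≈ (≡⇒≈ (det-antisym (proj₁ ⟦ u ⟧) (proj₂ ⟦ u ⟧) (proj₁ ⟦ v ⟧) (proj₂ ⟦ v ⟧)))
      (Is±1-neg (to (Adj⇔±1 {u} {v} ≈±-refl ≈±-refl) adj)))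

module PrimeField (p : ℕ) .{{_ : NonZero p}} (p-prime : Prime p) (2<p : 2 < p) where

  open Residues p

  pos-1+*≡* : ∀ a b c d → 1 ℕ.+ a ℕ.* b ≡ c ℕ.* d → 1ℤ + + a * + b ≡ + c * + d
  pos-1+*≡* a b c d eq =
    trans (cong (_+_ 1ℤ) (sym (ℤ.pos-* a b))) (trans (cong +_ eq) (ℤ.pos-* c d))

  inverse : ∀ {i} .{{_ : NonZero i}} → i < p → Σ ℤ λ c → + i * c ≈ 1ℤ
  inverse {i} i<p with coprime-Bézout (prime⇒coprime p-prime i<p)
  ... | Bézout.+- x y 1+yi≡xp = - + y ,
    ≈-trans (≡⇒≈ (sym (ℤ.neg-distribʳ-* (+ i) (+ y))))
      (1+b≡km⇒-b≈1 {k = + x} (trans (cong (_+_ 1ℤ) (ℤ.*-comm (+ i) (+ y))) (pos-1+*≡* y i x p 1+yi≡xp)))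
  ... | Bézout.-+ x y 1+xp≡yi = + y ,
    1+km≡b⇒b≈1 {k = + x} (trans (pos-1+*≡* x p y i 1+xp≡yi) (ℤ.*-comm (+ y) (+ i)))

  1≉0 : ¬ 1ℤ ≈ 0ℤ
  1≉0 1≈0 with ≈⇒≡ (ℕ.<-trans (ℕ.n<1+n 1) 2<p) (ℕ.>-nonZero⁻¹ p) 1≈0
  ... | ()

  1≉-1 : ¬ 1ℤ ≈ -1ℤ
  1≉-1 1≈-1 with ≈⇒≡ 2<p (ℕ.>-nonZero⁻¹ p) (+-cong 1≈-1 (≈-refl {1ℤ}))
  ... | ()

  module _ {u w : ℤ} (wu≈1 : w * u ≈ 1ℤ) where

    unit-inverseˡ : ∀ x → w * (u * x) ≈ x
    unit-inverseˡ x = begin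
      w * (u * x)  ≡⟨ solve (w ∷ u ∷ x ∷ []) ⟩
      (w * u) * x  ≈⟨ *-cong wu≈1 (≈-refl {x}) ⟩
      1ℤ * x       ≡⟨ ℤ.*-identityˡ x ⟩
      x            ∎
      where open import Relation.Binary.Reasoning.Setoid ≈-setoid

    unit-cancelˡ : ∀ {x y} → u * x ≈ u * y → x ≈ y
    unit-cancelˡ {x} {y} ux≈uy =
      ≈-trans (≈-sym (unit-inverseˡ x)) (≈-trans (*-cong (≈-refl {w}) ux≈uy) (unit-inverseˡ y))

    unit-≉0 : ¬ u ≈ 0ℤ
    unit-≉0 u≈0 = 1≉0 (≈-trans (≈-sym wu≈1)
      (≈-trans (*-cong (≈-refl {w}) u≈0) (≡⇒≈ (ℤ.*-zeroʳ w))))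

    unit-≉-neg : ¬ u ≈ - u
    unit-≉-neg u≈-u = 1≉-1 (≈-trans (≈-sym wu≈1)
      (≈-trans (*-cong (≈-refl {w}) u≈-u) (≈-trans (≡⇒≈ (sym (ℤ.neg-distribʳ-* w u))) (-‿cong wu≈1))))

module Cycle (p : ℕ) .{{_ : NonZero p}} (i : ℕ) (z : ℕ → Vertex p)
  (z-step : ∀ t → Adj p (z t) (z (suc t)))
  (z∈∂W : ∀ t → InDW p i (z t))
  (z-period : z p ≡ z 0)
  (z-injective : ∀ {s t} → z s ≡ z t → Residues._≈_ p (+ s) (+ t)) where

  open Residues p using (≉-within-period)
  open Vertices p using (Adj-sym)

  z-distinct : ∀ {s q} → s < q → q < s ℕ.+ p → z s ≢ z q
  z-distinct s<q q<s+p = ≉-within-period s<q q<s+p ∘ z-injective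

  ascending : ∀ {s e} → s ≤‴ e → Walk p (z s) (z e)
  ascending ≤‴-refl = stop _
  ascending {s} (≤‴-step s<e) = step (z-step s) (ascending s<e)

  descending : ∀ {s e} → s ≤′ e → Walk p (z e) (z s)
  descending ≤′-refl = stop _
  descending {e = suc e} (≤′-step s≤e) =
    step (Adj-sym {z e} {z (suc e)} (z-step e)) (descending s≤e)

  InSegment : ℕ → ℕ → Vertex p → Set
  InSegment lo hi v = Σ ℕ λ q → lo ≤ q × q ≤ hi × v ≡ z q

  ∈-ascending : ∀ {s e} (s≤e : s ≤‴ e) {v} → v ∈ verts p (ascending s≤e) → InSegment s e v
  ∈-ascending ≤‴-refl (here refl) = _ , ℕ.≤-refl , ℕ.≤-refl , refl
  ∈-ascending s≤e@(≤‴-step _) (here refl) = _ , ℕ.≤-refl , ≤‴⇒≤ s≤e , refl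
  ∈-ascending (≤‴-step s<e) (there v∈) with ∈-ascending s<e v∈
  ... | q , s<q , q≤e , v≡zq = q , ℕ.<⇒≤ s<q , q≤e , v≡zq

  ∈-descending : ∀ {s e} (s≤e : s ≤′ e) {v} → v ∈ verts p (descending s≤e) → InSegment s e v
  ∈-descending ≤′-refl (here refl) = _ , ℕ.≤-refl , ℕ.≤-refl , refl
  ∈-descending s≤e@(≤′-step _) (here refl) = _ , ≤′⇒≤ s≤e , ℕ.≤-refl , refl
  ∈-descending (≤′-step s≤e) (there v∈) with ∈-descending s≤e v∈
  ... | q , s≤q , q≤e , v≡zq = q , s≤q , ℕ.m≤n⇒m≤1+n q≤e , v≡zq

  ascending-path : ∀ {s e} (s≤e : s ≤‴ e) → e < s ℕ.+ p → IsPathIn p i (ascending s≤e)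
  ascending-path s≤e e<s+p = all∈∂W s≤e , unique s≤e e<s+p
    where
    all∈∂W : ∀ {s e} (s≤e : s ≤‴ e) → All (InDW p i) (verts p (ascending s≤e))
    all∈∂W {s} ≤‴-refl = z∈∂W s All.∷ All.[]
    all∈∂W {s} (≤‴-step s<e) = z∈∂W s All.∷ all∈∂W s<e
    unique : ∀ {s e} (s≤e : s ≤‴ e) → e < s ℕ.+ p → Unique (verts p (ascending s≤e))
    unique ≤‴-refl _ = All.[] AllPairs.∷ AllPairs.[]
    unique {s} (≤‴-step s<e) e<s+p = All.tabulate head-fresh AllPairs.∷ unique s<e (ℕ.m<n⇒m<1+n e<s+p)
      where
      head-fresh : ∀ {v} → v ∈ verts p (ascending s<e) → z s ≢ v
      head-fresh v∈ zs≡v with ∈-ascending s<e v∈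
      ... | q , s<q , q≤e , v≡zq = z-distinct s<q (ℕ.≤-<-trans q≤e e<s+p) (trans zs≡v v≡zq)

  descending-path : ∀ {s e} (s≤e : s ≤′ e) → e < s ℕ.+ p → IsPathIn p i (descending s≤e)
  descending-path s≤e e<s+p = all∈∂W s≤e , unique s≤e e<s+p
    where
    all∈∂W : ∀ {s e} (s≤e : s ≤′ e) → All (InDW p i) (verts p (descending s≤e))
    all∈∂W {s} ≤′-refl = z∈∂W s All.∷ All.[]
    all∈∂W {e = suc e} (≤′-step s≤e) = z∈∂W (suc e) All.∷ all∈∂W s≤e
    unique : ∀ {s e} (s≤e : s ≤′ e) → e < s ℕ.+ p → Unique (verts p (descending s≤e))
    unique ≤′-refl _ = All.[] AllPairs.∷ AllPairs.[]
    unique {s} {suc e} (≤′-step s≤e) e<s+p =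
      All.tabulate head-fresh AllPairs.∷ unique s≤e (ℕ.<-trans (ℕ.n<1+n e) e<s+p)
      where
      head-fresh : ∀ {v} → v ∈ verts p (descending s≤e) → z (suc e) ≢ v
      head-fresh v∈ ze≡v with ∈-descending s≤e v∈
      ... | q , s≤q , q≤e , v≡zq = z-distinct (s≤s q≤e) (ℕ.<-≤-trans e<s+p (ℕ.+-monoˡ-≤ p s≤q))
                                     (sym (trans ze≡v v≡zq))

  record Segment (x y : Vertex p) (lo hi : ℕ) : Set where
    field
      path   : PathIn p i x y
      within : ∀ {v} → v ∈ verts p (proj₁ path) → InSegment lo hi v

  upward : ∀ {s e} → s ≤ e → e < s ℕ.+ p → Segment (z s) (z e) s e
  upward s≤e e<s+p = record
    { path = ascending (≤⇒≤‴ s≤e) , ascending-path (≤⇒≤‴ s≤e) e<s+p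
    ; within = ∈-ascending (≤⇒≤‴ s≤e) }

  downward : ∀ {s e} → s ≤ e → e < s ℕ.+ p → Segment (z e) (z s) s e
  downward s≤e e<s+p = record
    { path = descending (≤⇒≤′ s≤e) , descending-path (≤⇒≤′ s≤e) e<s+p
    ; within = ∈-descending (≤⇒≤′ s≤e) }

  Apart : ℕ → ℕ → ℕ → ℕ → Set
  Apart lo₁ hi₁ lo₂ hi₂ = ∀ {q₁ q₂} → lo₁ ≤ q₁ → q₁ ≤ hi₁ → lo₂ ≤ q₂ → q₂ ≤ hi₂ → z q₁ ≢ z q₂

  apart : ∀ {lo₁ hi₁ lo₂ hi₂} → hi₁ < lo₂ → hi₂ < lo₁ ℕ.+ p → Apart lo₁ hi₁ lo₂ hi₂
  apart hi₁<lo₂ hi₂<lo₁+p lo₁≤q₁ q₁≤hi₁ lo₂≤q₂ q₂≤hi₂ = z-distinct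
    (ℕ.≤-<-trans q₁≤hi₁ (ℕ.<-≤-trans hi₁<lo₂ lo₂≤q₂))
    (ℕ.≤-<-trans q₂≤hi₂ (ℕ.<-≤-trans hi₂<lo₁+p (ℕ.+-monoˡ-≤ p lo₁≤q₁)))

  Apart-sym : ∀ {lo₁ hi₁ lo₂ hi₂} → Apart lo₁ hi₁ lo₂ hi₂ → Apart lo₂ hi₂ lo₁ hi₁
  Apart-sym apart₁₂ lo₂≤q₂ q₂≤hi₂ lo₁≤q₁ q₁≤hi₁ = apart₁₂ lo₁≤q₁ q₁≤hi₁ lo₂≤q₂ q₂≤hi₂ ∘ sym

  disjoint : ∀ {x₁ y₁ x₂ y₂ lo₁ hi₁ lo₂ hi₂} → Segment x₁ y₁ lo₁ hi₁ → Segment x₂ y₂ lo₂ hi₂ →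
             Apart lo₁ hi₁ lo₂ hi₂ → DisjointPaths p i x₁ x₂ y₁ y₂
  disjoint S₁ S₂ apart₁₂ = Segment.path S₁ , Segment.path S₂ , λ v v∈₁ v∈₂ →
    let q₁ , lo₁≤q₁ , q₁≤hi₁ , v≡zq₁ = Segment.within S₁ v∈₁
        q₂ , lo₂≤q₂ , q₂≤hi₂ , v≡zq₂ = Segment.within S₂ v∈₂
    in apart₁₂ lo₁≤q₁ q₁≤hi₁ lo₂≤q₂ q₂≤hi₂ (trans (sym v≡zq₁) v≡zq₂)

  -- If b ≤ u, join 0 to v backwards (through z p ≡ z 0) and b to u forwards; otherwise join
  -- 0 to u forwards and b to v, forwards if b ≤ v and backwards if not.
  linkage-ordered : ∀ {b u v} → 0 < b → b < p → u < v → v < p →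
                    Linkage p i (z 0) (z b) (z u) (z v)
  linkage-ordered {b} {u} {v} 0<b b<p u<v v<p with b ℕ.≤? u | b ℕ.≤? v
  ... | yes b≤u | _ = inj₂ (disjoint
    (subst (λ x → Segment x (z v) v p) z-period
      (downward (ℕ.<⇒≤ v<p) (ℕ.m<n+m p (ℕ.≤-<-trans ℕ.z≤n u<v))))
    (upward b≤u (ℕ.<-≤-trans (ℕ.<-trans u<v v<p) (ℕ.m≤n+m p b)))
    (Apart-sym (apart u<v (ℕ.+-monoˡ-< p 0<b))))
  ... | no b≰u | yes b≤v = inj₁ (disjoint
    (upward ℕ.z≤n (ℕ.<-trans u<v v<p))
    (upward b≤v (ℕ.<-≤-trans v<p (ℕ.m≤n+m p b)))
    (apart (ℕ.≰⇒> b≰u) v<p))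
  ... | no _ | no b≰v = inj₁ (disjoint
    (upward ℕ.z≤n (ℕ.<-trans u<v v<p))
    (downward (ℕ.<⇒≤ (ℕ.≰⇒> b≰v)) (ℕ.<-≤-trans b<p (ℕ.m≤n+m p v)))
    (apart u<v b<p))

  linkage : ∀ {b e f} → 0 < b → b < p → e < p → f < p → e ≢ f →
            Linkage p i (z 0) (z b) (z e) (z f)
  linkage {e = e} {f} 0<b b<p e<p f<p e≢f with ℕ.<-cmp e f
  ... | tri< e<f _ _ = linkage-ordered 0<b b<p e<f f<p
  ... | tri≈ _ e≡f _ = ⊥-elim (e≢f e≡f)
  ... | tri> _ _ f<e = swap (linkage-ordered 0<b b<p f<e e<p)

Linkage-resp-≡ : ∀ {p} .{{_ : NonZero p}} {i x₁ x₁′ x₂ x₂′ y₁ y₁′ y₂ y₂′} →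
  x₁ ≡ x₁′ → x₂ ≡ x₂′ → y₁ ≡ y₁′ → y₂ ≡ y₂′ → Linkage p i x₁ x₂ y₁ y₂ → Linkage p i x₁′ x₂′ y₁′ y₂′
Linkage-resp-≡ refl refl refl refl linkage = linkage

module Rim (p : ℕ) .{{_ : NonZero p}} (p-prime : Prime p) (2<p : 2 < p)
           (i : ℕ) .{{_ : NonZero i}} (i<p : i < p) where

  open Residues p
  open Vertices p
  open PrimeField p p-prime 2<p
  open import Relation.Binary.Reasoning.Setoid ≈-setoid

  I : ℤ
  I = + i

  opaque
    c : ℤ
    c = proj₁ (inverse i<p)

    Ic≈1 : I * c ≈ 1ℤ
    Ic≈1 = proj₂ (inverse i<p)

  cI≈1 : c * I ≈ 1ℤ
  cI≈1 = ≈-trans (≡⇒≈ (ℤ.*-comm c I)) Ic≈1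

  c≉0 : ¬ c ≈ 0ℤ
  c≉0 = unit-≉0 {c} {I} Ic≈1

  -- Kept opaque: unfolding the canonical representative makes unification intractable.
  opaque
    point : ℤ → Vertex p
    point α = proj₁ (vertex-of α c (c≉0 ∘ proj₂))

    point-≈± : ∀ α → ⟦ point α ⟧ ≈± (α , c)
    point-≈± α = proj₂ (vertex-of α c (c≉0 ∘ proj₂))

  point-cong : ∀ {α β} → α ≈ β → point α ≡ point β
  point-cong {α} {β} α≈β =
    ⟦⟧-injective (≈±-trans (point-≈± α) (≈±-trans (same α≈β ≈-refl) (≈±-sym (point-≈± β))))

  point-injective : ∀ {α β} → point α ≡ point β → α ≈ β
  point-injective {α} {β} eq
    with ≈±-trans (≈±-sym (point-≈± α)) (≈±-trans (≈±-reflexive (cong ⟦_⟧ eq)) (point-≈± β))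
  ... | same α≈β _ = α≈β
  ... | opposite _ c≈-c = ⊥-elim (unit-≉-neg {c} {I} Ic≈1 c≈-c)

  point∈∂W : ∀ α → InDW p i (point α)
  point∈∂W α = from (InDW⇔±1 {i} {point α} (point-≈± α))
    (inj₁ (≈-trans (≡⇒≈ (ℤ.+-identityʳ (I * c))) Ic≈1))

  I*y≈e⇒y≈c*e : ∀ {y e} → I * y ≈ e → y ≈ c * e
  I*y≈e⇒y≈c*e {y} I*y≈e = ≈-trans (≈-sym (unit-inverseˡ {I} {c} cI≈1 y)) (*-cong (≈-refl {c}) I*y≈e)

  I*y≈±1⇒y≈±c : ∀ {y} → Is±1 (I * y) → y ≈ c ⊎ y ≈ - c
  I*y≈±1⇒y≈±c (inj₁ I*y≈1) = inj₁ (≈-trans (I*y≈e⇒y≈c*e I*y≈1) (≡⇒≈ (ℤ.*-identityʳ c)))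
  I*y≈±1⇒y≈±c (inj₂ I*y≈-1) =
    inj₂ (≈-trans (I*y≈e⇒y≈c*e I*y≈-1) (≡⇒≈ (trans (ℤ.*-comm c -1ℤ) (ℤ.-1*i≡-i c))))

  point-surjective : ∀ {v} → InDW p i v → Σ ℤ λ α → point α ≡ v
  point-surjective {v} v∈∂W
    with I*y≈±1⇒y≈±c (Is±1-resp-≈ (≡⇒≈ (ℤ.+-identityʳ _)) (to (InDW⇔±1 {i} {v} ≈±-refl) v∈∂W))
  ... | inj₁ y≈c  = x , ⟦⟧-injective (≈±-trans (point-≈± x) (same ≈-refl (≈-sym y≈c)))
    where x = proj₁ ⟦ v ⟧
  ... | inj₂ y≈-c = - x , ⟦⟧-injective (≈±-trans (point-≈± (- x)) (opposite ≈-refl (≈-neg-flip y≈-c)))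
    where x = proj₁ ⟦ v ⟧

  coordinate : DW p i → ℤ
  coordinate (v , v∈∂W) = proj₁ (point-surjective {v} v∈∂W)

  point-coordinate : ∀ v → point (coordinate v) ≡ proj₁ v
  point-coordinate (v , v∈∂W) = proj₂ (point-surjective {v} v∈∂W)

  coordinate-point : ∀ α → coordinate (point α , point∈∂W α) ≈ α
  coordinate-point α = point-injective (point-coordinate (point α , point∈∂W α))

  point-step : ∀ α → Adj p (point α) (point (α + I))
  point-step α = from (Adj⇔±1 {point α} {point (α + I)} (point-≈± α) (point-≈± (α + I)))
    (inj₂ (≈-trans (≡⇒≈ (ax-x[a+y]≡-yx α c I)) (-‿cong Ic≈1)))
    where
    ax-x[a+y]≡-yx : ∀ a x y → a * x - x * (a + y) ≡ - (y * x)
    ax-x[a+y]≡-yx = solve-∀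

  progression : ℤ → ℕ → ℤ
  progression α₀ zero = α₀
  progression α₀ (suc t) = progression α₀ t + I

  progression-≡ : ∀ α₀ t → progression α₀ t ≡ α₀ + + t * I
  progression-≡ α₀ zero = sym (ℤ.+-identityʳ α₀)
  progression-≡ α₀ (suc t) = trans (cong (_+ I) (progression-≡ α₀ t)) (+-step α₀ (+ t) I)
    where
    +-step : ∀ a t x → (a + t * x) + x ≡ a + (1ℤ + t) * x
    +-step = solve-∀

  progression-period : ∀ α₀ → progression α₀ p ≈ α₀
  progression-period α₀ = begin
    progression α₀ p  ≡⟨ progression-≡ α₀ p ⟩
    α₀ + + p * I      ≈⟨ +-cong (≈-refl {α₀}) (*-cong m≈0 (≈-refl {I})) ⟩
    α₀ + 0ℤ           ≡⟨ ℤ.+-identityʳ α₀ ⟩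
    α₀                ∎

  progression-injective : ∀ α₀ {s t} → progression α₀ s ≈ progression α₀ t → + s ≈ + t
  progression-injective α₀ {s} {t} αₛ≈αₜ = unit-cancelˡ {I} {c} cI≈1 (begin
    I * + s  ≡⟨ ℤ.*-comm I (+ s) ⟩
    + s * I  ≈⟨ +-cancelˡ α₀ (begin
      α₀ + + s * I      ≡⟨ progression-≡ α₀ s ⟨
      progression α₀ s  ≈⟨ αₛ≈αₜ ⟩
      progression α₀ t  ≡⟨ progression-≡ α₀ t ⟩
      α₀ + + t * I      ∎) ⟩
    + t * I  ≡⟨ ℤ.*-comm (+ t) I ⟩
    I * + t  ∎)

  progression-surjective : ∀ α₀ α → progression α₀ (((α - α₀) * c) %ℕ p) ≈ α
  progression-surjective α₀ α = begin
    progression α₀ t        ≡⟨ progression-≡ α₀ t ⟩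
    α₀ + + t * I            ≈⟨ +-cong (≈-refl {α₀}) (*-cong (%ℕ-≈ ((α - α₀) * c)) (≈-refl {I})) ⟩
    α₀ + (α - α₀) * c * I   ≡⟨ *-assoc-in-sum α₀ (α - α₀) c I ⟩
    α₀ + (α - α₀) * (c * I) ≈⟨ +-cong (≈-refl {α₀}) (*-cong (≈-refl {α - α₀}) cI≈1) ⟩
    α₀ + (α - α₀) * 1ℤ      ≡⟨ a+[b-a]*1≡b α₀ α ⟩
    α                       ∎
    where
    t = ((α - α₀) * c) %ℕ p
    *-assoc-in-sum : ∀ a d x y → a + d * x * y ≡ a + d * (x * y)
    *-assoc-in-sum = solve-∀
    a+[b-a]*1≡b : ∀ a b → a + (b - a) * 1ℤ ≡ b
    a+[b-a]*1≡b = solve-∀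

  module Around (α₀ : ℤ) where

    z : ℕ → Vertex p
    z t = point (progression α₀ t)

    position : ∀ v → Σ ℕ λ t → t < p × z t ≡ proj₁ v
    position v = _ , n%ℕd<d ((coordinate v - α₀) * c) p ,
      trans (point-cong (progression-surjective α₀ (coordinate v))) (point-coordinate v)

    open Cycle p i z (λ t → point-step (progression α₀ t)) (λ t → point∈∂W (progression α₀ t))
      (point-cong (progression-period α₀)) (progression-injective α₀ ∘ point-injective)
      public using (linkage)
  two-linkage : (x₁ x₂ y₁ y₂ : Vertex p) → InDW p i x₁ → InDW p i x₂ → InDW p i y₁ →
    InDW p i y₂ → x₁ ≢ x₂ → y₁ ≢ y₂ → Linkage p i x₁ x₂ y₁ y₂
  two-linkage x₁ x₂ y₁ y₂ x₁∈∂W x₂∈∂W y₁∈∂W y₂∈∂W x₁≢x₂ y₁≢y₂ =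
    let α₀ , z0≡x₁ = point-surjective {x₁} x₁∈∂W
        b , b<p , zb≡x₂ = Around.position α₀ (x₂ , x₂∈∂W)
        e , e<p , ze≡y₁ = Around.position α₀ (y₁ , y₁∈∂W)
        f , f<p , zf≡y₂ = Around.position α₀ (y₂ , y₂∈∂W)
    in Linkage-resp-≡ {i = i} z0≡x₁ zb≡x₂ ze≡y₁ zf≡y₂ (Around.linkage α₀
         (ℕ.n≢0⇒n>0 λ b≡0 → x₁≢x₂ (trans (sym z0≡x₁) (trans (cong (Around.z α₀) (sym b≡0)) zb≡x₂)))
         b<p e<p f<p
         λ e≡f → y₁≢y₂ (trans (sym ze≡y₁) (trans (cong (Around.z α₀) e≡f) zf≡y₂)))

module TwoRims (p : ℕ) .{{_ : NonZero p}} (p-prime : Prime p) (2<p : 2 < p)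
               (i j : ℕ) .{{_ : NonZero i}} .{{_ : NonZero j}} (i<p : i < p) (j<p : j < p) where

  open Residues p
  open Vertices p
  open PrimeField p p-prime 2<p
  open import Relation.Binary.Reasoning.Setoid ≈-setoid

  module Rᵢ = Rim p p-prime 2<p i i<p
  module Rⱼ = Rim p p-prime 2<p j j<p
  open Rᵢ using (I; c; Ic≈1; cI≈1)
  open Rⱼ using () renaming (I to J; c to d; Ic≈1 to Jd≈1)

  Adj-points⇔ : ∀ α β → Adj p (Rᵢ.point α) (Rⱼ.point β) ⇔ Is±1 (detℤ (α , c) (β , d))
  Adj-points⇔ α β = Adj⇔±1 {Rᵢ.point α} {Rⱼ.point β} (Rᵢ.point-≈± α) (Rⱼ.point-≈± β)

  partner : ℤ → ℤ → ℤ
  partner e α = I * (α * d - e)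

  partner-cong : ∀ e {α α′} → α ≈ α′ → partner e α ≈ partner e α′
  partner-cong e {α} α≈α′ = *-cong (≈-refl {I}) (+-cong (*-cong α≈α′ (≈-refl {d})) (≈-refl { - e}))

  det-partner : ∀ e α → detℤ (α , c) (partner e α , d) ≈ e
  det-partner e α = begin
    α * d - c * (I * (α * d - e))  ≈⟨ +-cong (≈-refl {α * d}) (-‿cong (unit-inverseˡ {I} {c} cI≈1 _)) ⟩
    α * d - (α * d - e)            ≡⟨ x-[x-y]≡y (α * d) e ⟩
    e                              ∎
    where
    x-[x-y]≡y : ∀ x y → x - (x - y) ≡ y
    x-[x-y]≡y = solve-∀

  det≈⇒partner : ∀ {e α β} → detℤ (α , c) (β , d) ≈ e → β ≈ partner e α
  det≈⇒partner {e} {α} {β} det≈e = begin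
    β                        ≈⟨ unit-inverseˡ {c} {I} Ic≈1 β ⟨
    I * (c * β)              ≡⟨ cong (I *_) (x≡y-[y-x] (c * β) (α * d)) ⟩
    I * (α * d - (α * d - c * β)) ≈⟨ *-cong (≈-refl {I}) (+-cong (≈-refl {α * d}) (-‿cong det≈e)) ⟩
    I * (α * d - e)          ∎
    where
    x≡y-[y-x] : ∀ x y → x ≡ y - (y - x)
    x≡y-[y-x] = solve-∀

  partner-adjacent : ∀ {e} α → Is±1 e → Adj p (Rᵢ.point α) (Rⱼ.point (partner e α))
  partner-adjacent {e} α ±1 = from (Adj-points⇔ α _) (Is±1-resp-≈ (≈-sym (det-partner e α)) ±1)

  partners-distinct : ∀ α → Rⱼ.point (partner 1ℤ α) ≢ Rⱼ.point (partner -1ℤ α)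
  partners-distinct α eq = 1≉-1 (≈-sym
    (+-cancelˡ (α * d) (unit-cancelˡ {I} {c} cI≈1 (Rⱼ.point-injective eq))))

  only-partners : ∀ α {y} → InDW p j y → Adj p (Rᵢ.point α) y →
                  y ≡ Rⱼ.point (partner 1ℤ α) ⊎ y ≡ Rⱼ.point (partner -1ℤ α)
  only-partners α {y} y∈∂W adj with Rⱼ.point-surjective {y} y∈∂W
  ... | β , refl with to (Adj-points⇔ α β) adj
  ...   | inj₁ det≈1  = inj₁ (Rⱼ.point-cong (det≈⇒partner {α = α} det≈1))
  ...   | inj₂ det≈-1 = inj₂ (Rⱼ.point-cong (det≈⇒partner {α = α} det≈-1))

  exactly-two-neighbours : ∀ x → InDW p i x → ExactlyTwoNbrsIn p j x
  exactly-two-neighbours x x∈∂W with Rᵢ.point-surjective {x} x∈∂W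
  ... | α , refl =
    Rⱼ.point (partner 1ℤ α) , Rⱼ.point (partner -1ℤ α) , partners-distinct α ,
    (Rⱼ.point∈∂W _ , partner-adjacent α (inj₁ ≈-refl)) ,
    (Rⱼ.point∈∂W _ , partner-adjacent α (inj₂ ≈-refl)) ,
    λ y y∈∂W → only-partners α y∈∂W

  partner⁻¹ : ℤ → ℤ
  partner⁻¹ β = J * (c * β + 1ℤ)

  partner⁻¹-cong : ∀ {β β′} → β ≈ β′ → partner⁻¹ β ≈ partner⁻¹ β′
  partner⁻¹-cong β≈β′ = *-cong (≈-refl {J}) (+-cong (*-cong (≈-refl {c}) β≈β′) (≈-refl {1ℤ}))

  partner-partner⁻¹ : ∀ β → partner 1ℤ (partner⁻¹ β) ≈ β
  partner-partner⁻¹ β = begin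
    I * (J * (c * β + 1ℤ) * d - 1ℤ)    ≡⟨ cong (λ t → I * (t - 1ℤ)) (*-rotate J (c * β + 1ℤ) d) ⟩
    I * (J * (d * (c * β + 1ℤ)) - 1ℤ)
      ≈⟨ *-cong (≈-refl {I}) (+-cong (unit-inverseˡ {d} {J} Jd≈1 _) (≈-refl { -1ℤ})) ⟩
    I * (c * β + 1ℤ - 1ℤ)              ≡⟨ cong (I *_) (x+1-1≡x (c * β)) ⟩
    I * (c * β)                        ≈⟨ unit-inverseˡ {c} {I} Ic≈1 β ⟩
    β                                  ∎
    where
    *-rotate : ∀ x y z → x * y * z ≡ x * (z * y)
    *-rotate = solve-∀
    x+1-1≡x : ∀ x → x + 1ℤ - 1ℤ ≡ x
    x+1-1≡x = solve-∀

  partner⁻¹-partner : ∀ α → partner⁻¹ (partner 1ℤ α) ≈ α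
  partner⁻¹-partner α = begin
    J * (c * (I * (α * d - 1ℤ)) + 1ℤ)
      ≈⟨ *-cong (≈-refl {J}) (+-cong (unit-inverseˡ {I} {c} cI≈1 _) (≈-refl {1ℤ})) ⟩
    J * (α * d - 1ℤ + 1ℤ)              ≡⟨ cong (J *_) (xy-1+1≡yx α d) ⟩
    J * (d * α)                        ≈⟨ unit-inverseˡ {d} {J} Jd≈1 α ⟩
    α                                  ∎
    where
    xy-1+1≡yx : ∀ x y → x * y - 1ℤ + 1ℤ ≡ y * x
    xy-1+1≡yx = solve-∀

  Φ : DW p i → DW p j
  Φ v = Rⱼ.point (partner 1ℤ (Rᵢ.coordinate v)) , Rⱼ.point∈∂W _

  Φ⁻¹ : DW p j → DW p i
  Φ⁻¹ w = Rᵢ.point (partner⁻¹ (Rⱼ.coordinate w)) , Rᵢ.point∈∂W _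

  Φ-Φ⁻¹ : ∀ w → Φ (Φ⁻¹ w) ≡ w
  Φ-Φ⁻¹ w = DW-≡ {j} (trans (Rⱼ.point-cong (≈-trans (partner-cong 1ℤ (Rᵢ.coordinate-point _))
    (partner-partner⁻¹ _))) (Rⱼ.point-coordinate w))

  Φ⁻¹-Φ : ∀ v → Φ⁻¹ (Φ v) ≡ v
  Φ⁻¹-Φ v = DW-≡ {i} (trans (Rᵢ.point-cong (≈-trans (partner⁻¹-cong (Rⱼ.coordinate-point _))
    (partner⁻¹-partner _))) (Rᵢ.point-coordinate v))

  Φ-adjacent : ∀ v → Adj p (proj₁ v) (proj₁ (Φ v))
  Φ-adjacent v = subst (λ x → Adj p x (proj₁ (Φ v))) (Rᵢ.point-coordinate v)
    (partner-adjacent (Rᵢ.coordinate v) (inj₁ ≈-refl))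

  adjacent-matching : Σ (DW p i ⤖ DW p j) λ Ψ → ∀ v → Adj p (proj₁ v) (proj₁ (Bijection.to Ψ v))
  adjacent-matching = ↔⇒⤖ (mk↔ₛ′ Φ Φ⁻¹ Φ-Φ⁻¹ Φ⁻¹-Φ) , Φ-adjacent

odd-prime⇒2<p : ∀ {p} → Prime p → p % 2 ≡ 1 → 2 < p
odd-prime⇒2<p {p} p-prime p-odd =
  ℕ.≤∧≢⇒< (ℕ.nonTrivial⇒n>1 p {{prime⇒nonTrivial p-prime}}) (λ { refl → 0≢1 p-odd })
  where
  0≢1 : 0 ≢ 1
  0≢1 ()

lemma3p1 : (p : ℕ) .{{_ : NonZero p}} → Prime p → p % 2 ≡ 1 →
    (i j : ℕ) → 1 ≤ i → i ≤ (p ∸ 1) / 2 → 1 ≤ j → j ≤ (p ∸ 1) / 2 →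
    ((x₁ x₂ y₁ y₂ : Vertex p) → InDW p i x₁ → InDW p i x₂ → InDW p i y₁ → InDW p i y₂ →
        x₁ ≢ x₂ → y₁ ≢ y₂ → Linkage p i x₁ x₂ y₁ y₂)
    × ((x : Vertex p) → InDW p i x → ExactlyTwoNbrsIn p j x)
    × (i ≢ j → Σ (DW p i ⤖ DW p j)
        (λ Φ → (v : DW p i) → Adj p (proj₁ v) (proj₁ (Bijection.to Φ v))))
-- Part (c) holds for i = j as well.
lemma3p1 p p-prime p-odd i j 1≤i i≤n 1≤j j≤n =
  Rim.two-linkage p p-prime 2<p i {{ℕ.>-nonZero 1≤i}} (<p i≤n) ,
  Rims.exactly-two-neighbours ,
  λ _ → Rims.adjacent-matching
  where
  2<p : 2 < p
  2<p = odd-prime⇒2<p p-prime p-odd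
  <p : ∀ {k} → k ≤ (p ∸ 1) / 2 → k < p
  <p k≤n = ℕ.m≤pred[n]⇒suc[m]≤n (ℕ.≤-trans k≤n (m/n≤m (p ∸ 1) 2))
  module Rims = TwoRims p p-prime 2<p i j {{ℕ.>-nonZero 1≤i}} {{ℕ.>-nonZero 1≤j}} (<p i≤n) (<p j≤n)
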